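{- Let $G$ be a (three-dimensional, orientable) GFT tensor graph, possibly containing passive edges, and let $e$ be an active edge of $G$ which is regular (i.e. neither a bridge nor a self-loop). Then $$\mathcal T_G(x,y,z,t)=\mathcal T_{G-e}(x,y,z,t)+\mathcal T_{G/e}(x,y,z,t),$$ where $G-e$ is obtained from $G$ by deleting $e$, $G/e$ is obtained from $G$ by contracting $e$ in the tensor-graph sense (i.e. $e$ is kept but declared passive), and for any GFT tensor graph $G'$ $$\mathcal T_{G'}(x,y,z,t)=\sum_{H\subset G'} (x-1)^{r(G')-r(H)}\,y^{n(H)}\,z^{k(H)-F(H)+n(H)}\,t^{2\sum_{\mathcal B(H)} g_{\mathcal B(H)}}.$$
   Context: A GFT tensor graph (three-dimensional case) is a graph in which every vertex has valence four (dual to a tetrahedron) and every edge consists of three strands (dual to the three edges of a triangle), with a fixed, twist-free matching of strands at vertices; such graphs are taken to be orientable (their dual simplicial complexes are orientable). Erasing one strand of each edge (the middle strand of vertical edges and the lower strand of horizontal edges in the standard vertex drawing) yields a ribbon graph, the jacket graph, which is in bijection with the tensor graph; rank, nullity, connected components and boundary components of subgraphs are computed on this ribbon graph. Edges are of two kinds: active and passive; deletion and contraction are only applied to active edges, and contracting an edge means turning it from active to passive (its endpoints are not identified). The sum $\sum_{H\subset G'}$ runs over spanning subgraphs $H$ (subsets of edges, with all vertices), where all passive edges of $G'$ are always included in $H$ and the active edges range over all subsets. For a subgraph $A$: $k(A)$ is the number of connected components, $r(A)=V-k(A)$ is the rank ($V$ the number of vertices), $n(A)=|A|-r(A)$ is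 the nullity, and $F(A)$ is the number of boundary components (faces) of $A$ viewed as a ribbon (jacket) graph. A bubble of $H$ is a closed three-dimensional region of the tensor graph $H$ formed by its strands; each bubble $\mathcal B(H)$ is a ribbon graph and its genus $g_{\mathcal B(H)}$ is defined by $2-2g=V-E+F$ (vertices, edges, faces of the bubble). The sum $\sum_{\mathcal B(H)}$ runs over all bubbles of $H$. -}

module Defs where

open import Data.Nat as ℕ using (ℕ; zero; suc; _+_; _*_; _∸_; _⊓_; _⊔_; _≡ᵇ_; _%_; _<_)
open import Data.Bool using (Bool; true; false; if_then_else_; _∧_; _∨_; not)
open import Data.Fin using (Fin; toℕ)
open import Data.List using (List; []; _∷_; _++_; map; concatMap; foldl; filterᵇ; length; upTo; removeAt; updateAt; lookup)
open import Data.Bool.ListAction using (any)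
open import Data.List.Relation.Unary.Unique.Propositional using (Unique)
open import Data.Product using (Σ; _×_; _,_; proj₁; proj₂)
open import Data.List.Relation.Unary.All using (All)
open import Data.Integer as ℤ using (ℤ; +_)
open import Relation.Binary.PropositionalEquality using (_≡_)
open import Relation.Nullary using (¬_)
open import Relation.Nullary.Decidable using (does)

-- Points are natural-number codes; `components pts es` is the number of
-- connected components of the graph with vertex set `pts` and edge list
-- `es` (edges must join points of `pts`).  Labels: every point carries the
-- least code of its current class; merging relabels the larger label.

merge : (ℕ → ℕ) → ℕ × ℕ → (ℕ → ℕ)
merge f (x , y) i =
  let lx = f x ; ly = f y ; m = lx ⊓ ly ; M = lx ⊔ ly
  in if f i ≡ᵇ M then m else f i

labels : List (ℕ × ℕ) → ℕ → ℕ
labels es = foldl merge (λ i → i) es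

components : List ℕ → List (ℕ × ℕ) → ℕ
components pts es = length (filterᵇ (λ i → labels es i ≡ᵇ i) pts)

-- A vertex (tetrahedron) has 4 slots (half-edges / triangles) 0..3; the
-- strand at slot a in position j ∈ {0,1,2} goes to slot (a + 3 - j) mod 4,
-- i.e. the standard vertex  φ(g1,g2,g3)φ(g3,g4,g5)φ(g5,g2,g6)φ(g6,g4,g1).
-- An edge joins slot s₁ of v₁ to slot s₂ of v₂, strand position j being
-- glued to strand position 2 - j (twist-free propagator: the outer strands
-- are exchanged and the middle strand stays in the middle, so the jacket
-- ribbon edges are untwisted).

record Edge (V : ℕ) : Set where
  constructor mkEdge
  field
    v₁ : Fin V
    s₁ : Fin 4
    v₂ : Fin V
    s₂ : Fin 4
    active : Bool

record TensorGraph : Set where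
  constructor mkTG
  field
    V     : ℕ
    edges : List (Edge V)

open TensorGraph public

-- Well-formedness: every slot of every vertex carries at most one edge end
-- (unused slots are external legs, e.g. after deletions).
halfEdges : ∀ {V} → List (Edge V) → List (Fin V × Fin 4)
halfEdges = concatMap (λ e → (Edge.v₁ e , Edge.s₁ e) ∷ (Edge.v₂ e , Edge.s₂ e) ∷ [])

WellFormed : TensorGraph → Set
WellFormed G = Unique (halfEdges (edges G))

-- position of the strand from slot a to slot b inside slot a
pos : ℕ → ℕ → ℕ
pos a b = (a + 3 ∸ b + 4) % 4
-- slot reached by the strand in position j of slot a
other : ℕ → ℕ → ℕ
other a j = (a + 3 ∸ j + 4) % 4

-- Spanning subgraphs: masks aligned with the edge list.
-- Passive edges are always present; active edges range over all choices.

subgraphMasks : List Bool → List (List Bool)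
subgraphMasks []            = [] ∷ []
subgraphMasks (true  ∷ as)  = map (true ∷_) (subgraphMasks as) ++ map (false ∷_) (subgraphMasks as)
subgraphMasks (false ∷ as)  = map (true ∷_) (subgraphMasks as)

masks : TensorGraph → List (List Bool)
masks G = subgraphMasks (map Edge.active (edges G))

select : ∀ {V} → List (Edge V) → List Bool → List (Edge V)
select []       _           = []
select (_ ∷ _)  []          = []
select (e ∷ es) (true ∷ m)  = e ∷ select es m
select (e ∷ es) (false ∷ m) = select es m

vertexCodes : ℕ → List ℕ
vertexCodes V = upTo V

kC : (V : ℕ) → List (Edge V) → ℕ
kC V es = components (vertexCodes V) (map (λ e → toℕ (Edge.v₁ e) , toℕ (Edge.v₂ e)) es)

rk : (V : ℕ) → List (Edge V) → ℕ
rk V es = V ∸ kC V es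

nul : (V : ℕ) → List (Edge V) → ℕ
nul V es = length es ∸ rk V es

slotUsed : ∀ {V} → List (Edge V) → ℕ → ℕ → Bool
slotUsed es v a = any (λ e → ((toℕ (Edge.v₁ e) ≡ᵇ v) ∧ (toℕ (Edge.s₁ e) ≡ᵇ a))
                           ∨ ((toℕ (Edge.v₂ e) ≡ᵇ v) ∧ (toℕ (Edge.s₂ e) ≡ᵇ a))) es

-- Jacket ribbon graph: erase the middle strand (position 1) of every edge.
-- Remaining strand ends at slot a: L = position 0 (to slot a-1),
-- R = position 2 (to slot a+1).  The vertex strands glue (a,R) to (a+1,L).
-- Boundary points (v,a,p), code v*8 + a*2 + p.  F(A) = number of closed
-- boundary curves: at a slot carrying an edge of A the strands follow the
-- edge (L ↔ R, positions j ↦ 2 - j); at a slot not carrying an edge of A the boundary turns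
-- around (L ↔ R).

jpt : ℕ → ℕ → ℕ → ℕ
jpt v a p = v * 8 + a * 2 + p

jacketPoints : ℕ → List ℕ
jacketPoints V = upTo (V * 8)

jacketEdges : (V : ℕ) → List (Edge V) → List (ℕ × ℕ)
jacketEdges V es =
     concatMap (λ v → map (λ a → jpt v a 1 , jpt v ((a + 1) % 4) 0) (upTo 4)) (upTo V)
  ++ concatMap (λ e → let v = toℕ (Edge.v₁ e) ; a = toℕ (Edge.s₁ e)
                          w = toℕ (Edge.v₂ e) ; b = toℕ (Edge.s₂ e)
                      in (jpt v a 0 , jpt w b 1) ∷ (jpt v a 1 , jpt w b 0) ∷ []) es
  ++ concatMap (λ v → concatMap (λ a → if slotUsed es v a then [] else (jpt v a 0 , jpt v a 1) ∷ [])
                                (upTo 4)) (upTo V)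

faces : (V : ℕ) → List (Edge V) → ℕ
faces V es = components (jacketPoints V) (jacketEdges V es)

-- Each vertex v carries 4 bubble vertices (v,c) (c = vertex of the
-- tetrahedron, opposite to slot c); (v,c) is a trivalent ribbon vertex whose
-- half-edges are the slots a ≠ c and whose corners are the strands between
-- slots a,b ≠ c.  Each edge of H yields 3 bubble edges.  Boundary points of
-- the bubble ribbon graphs: (v,c,a,b), a,b,c distinct = side b of half-edge a
-- of bubble vertex (v,c); code v*64 + c*16 + a*4 + b.

bpt : ℕ → ℕ → ℕ → ℕ → ℕ
bpt v c a b = v * 64 + c * 16 + a * 4 + b

distinct3 : ℕ → ℕ → ℕ → Bool
distinct3 a b c = not (a ≡ᵇ b) ∧ not (b ≡ᵇ c) ∧ not (a ≡ᵇ c)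

triples : List (ℕ × ℕ × ℕ)
triples = filterᵇ (λ t → distinct3 (proj₁ t) (proj₁ (proj₂ t)) (proj₂ (proj₂ t)))
            (concatMap (λ c → concatMap (λ a → map (λ b → c , a , b) (upTo 4)) (upTo 4)) (upTo 4))

bubblePoints : ℕ → List ℕ
bubblePoints V = concatMap (λ v → map (λ t → bpt v (proj₁ t) (proj₁ (proj₂ t)) (proj₂ (proj₂ t))) triples) (upTo V)

-- fourth slot
fourth : ℕ → ℕ → ℕ → ℕ
fourth a b c = 6 ∸ (a + b + c)

-- gluing of the bubble boundary along a half-edge (v,a) joined to (w,a'):
-- side b of bubble vertex c goes to side b' of bubble vertex c'
glueSide : ℕ → ℕ → ℕ → ℕ → ℕ → ℕ → ℕ × ℕ
glueSide v a w a' c b =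
  let d = fourth a b c ; b' = other a' (2 ∸ pos a b) ; d' = other a' (2 ∸ pos a d)
      c' = fourth a' b' d'
  in bpt v c a b , bpt w c' a' b'

-- bubble vertex reached: (v,c) at half-edge a ↦ (w,c')
glueVertex : ℕ → ℕ → ℕ → ℕ → ℕ → ℕ × ℕ
glueVertex v a w a' c =
  let bb = if other a 0 ≡ᵇ c then other a 1 else other a 0 in
  let d = fourth a bb c ; b' = other a' (2 ∸ pos a bb) ; d' = other a' (2 ∸ pos a d)
  in v * 4 + c , w * 4 + fourth a' b' d'

sidesOfSlot : ℕ → List (ℕ × ℕ)
sidesOfSlot a = filterᵇ (λ p → distinct3 a (proj₁ p) (proj₂ p))
                  (concatMap (λ c → map (λ b → c , b) (upTo 4)) (upTo 4))

bubbleFaceEdges : (V : ℕ) → List (Edge V) → List (ℕ × ℕ)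
bubbleFaceEdges V es =
     concatMap (λ v → map (λ t → bpt v (proj₁ t) (proj₁ (proj₂ t)) (proj₂ (proj₂ t))
                              , bpt v (proj₁ t) (proj₂ (proj₂ t)) (proj₁ (proj₂ t))) triples) (upTo V)
  ++ concatMap (λ e → let v = toℕ (Edge.v₁ e) ; a = toℕ (Edge.s₁ e)
                          w = toℕ (Edge.v₂ e) ; b = toℕ (Edge.s₂ e)
                      in map (λ p → glueSide v a w b (proj₁ p) (proj₂ p)) (sidesOfSlot a)
                      ++ map (λ p → glueSide w b v a (proj₁ p) (proj₂ p)) (sidesOfSlot b)) es
  ++ concatMap (λ v → concatMap (λ a → if slotUsed es v a then []
                       else map (λ p → bpt v (proj₁ p) a (proj₂ p) , bpt v (proj₁ p) a (fourth a (proj₁ p) (proj₂ p)))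
                                (sidesOfSlot a)) (upTo 4)) (upTo V)

bubbleVertexEdges : (V : ℕ) → List (Edge V) → List (ℕ × ℕ)
bubbleVertexEdges V es =
  concatMap (λ e → let v = toℕ (Edge.v₁ e) ; a = toℕ (Edge.s₁ e)
                       w = toℕ (Edge.v₂ e) ; b = toℕ (Edge.s₂ e)
                   in map (λ c → glueVertex v a w b c) (filterᵇ (λ c → not (c ≡ᵇ a)) (upTo 4))) es

numBubbles : (V : ℕ) → List (Edge V) → ℕ
numBubbles V es = components (upTo (V * 4)) (bubbleVertexEdges V es)

bubbleFaces : (V : ℕ) → List (Edge V) → ℕ
bubbleFaces V es = components (bubblePoints V) (bubbleFaceEdges V es)

-- 2 Σ_B g_B = Σ_B (2 - V_B + E_B - F_B) = 2·#bubbles - 4V + 3|H| - ΣF_B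
twiceGenusSum : (V : ℕ) → List (Edge V) → ℕ
twiceGenusSum V es = (2 * numBubbles V es + 3 * length es) ∸ (4 * V + bubbleFaces V es)

-- The polynomial, evaluated at integers x y z t.
-- Exponent of z: k(H) - F(H) + n(H) (= 2 g(H) ≥ 0, computed as (k+n) ∸ F).

term : (G : TensorGraph) → List Bool → ℤ → ℤ → ℤ → ℤ → ℤ
term G m x y z t =
  let V = TensorGraph.V G ; H = select (edges G) m in
      ((x ℤ.- + 1) ℤ.^ (rk V (edges G) ∸ rk V H))
  ℤ.* (y ℤ.^ nul V H)
  ℤ.* (z ℤ.^ ((kC V H + nul V H) ∸ faces V H))
  ℤ.* (t ℤ.^ twiceGenusSum V H)

sumℤ : List ℤ → ℤ
sumℤ = Data.List.foldr ℤ._+_ (+ 0)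

TPoly : TensorGraph → ℤ → ℤ → ℤ → ℤ → ℤ
TPoly G x y z t = sumℤ (map (λ m → term G m x y z t) (masks G))

EdgeIx : TensorGraph → Set
EdgeIx G = Fin (length (edges G))

_─_ : (G : TensorGraph) → EdgeIx G → TensorGraph
G ─ e = mkTG (TensorGraph.V G) (removeAt (edges G) e)

_／_ : (G : TensorGraph) → EdgeIx G → TensorGraph
G ／ e = mkTG (TensorGraph.V G)
              (updateAt (edges G) e (λ d → mkEdge (Edge.v₁ d) (Edge.s₁ d) (Edge.v₂ d) (Edge.s₂ d) false))

IsActive : (G : TensorGraph) → EdgeIx G → Set
IsActive G e = Edge.active (lookup (edges G) e) ≡ true

IsSelfLoop : (G : TensorGraph) → EdgeIx G → Set
IsSelfLoop G e = Edge.v₁ (lookup (edges G) e) ≡ Edge.v₂ (lookup (edges G) e)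

IsBridge : (G : TensorGraph) → EdgeIx G → Set
IsBridge G e = kC (TensorGraph.V G) (edges G) < kC (TensorGraph.V G) (edges (G ─ e))

IsRegular : (G : TensorGraph) → EdgeIx G → Set
IsRegular G e = ¬ IsBridge G e × ¬ IsSelfLoop G e

-- Tetrahedron v has vertices 0..3; slot a is the triangle opposite vertex a,
-- and strand position j of slot a is the triangle edge opposite the vertex
-- other a j.  With the standard orientation [0123], the ordered triangle
-- (other a 0, other a 1, other a 2) carries the induced boundary orientation
-- times  ε a = -1 (a even), +1 (a odd).  An edge maps the vertex at
-- position j of one triangle to the vertex at position 2 - j of the other
-- (an odd reordering).  Choosing orientations o v ∈ {±1} (true = +1), the
-- complex is orientable iff the glued triangles always receive opposite
-- induced orientations, i.e.  o v · ε s₁ = o w · ε s₂  for every edge.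

parity : Fin 4 → Bool   -- true iff ε = +1 (odd slot)
parity a = not ((toℕ a % 2) ≡ᵇ 0)

_xor_ : Bool → Bool → Bool
true  xor b = not b
false xor b = b

Orientable : TensorGraph → Set
Orientable G = Σ (Fin (TensorGraph.V G) → Bool) λ o →
  All (λ e → (o (Edge.v₁ e) xor parity (Edge.s₁ e)) ≡ (o (Edge.v₂ e) xor parity (Edge.s₂ e))) (edges G)

-- Split the sum over spanning subgraphs H of G according to whether H contains e. The subgraphs
-- avoiding e are exactly those of G − e. The subgraphs containing e correspond to those of G / e,
-- where e is passive and therefore always present; since every term depends on the edges of H but
-- not on which of them are active, this half is the sum defining T_{G/e}. The prefactor (x−1)^{r(G)−r(H)}
-- also agrees on both sides: contraction does not change the rank, and deletion does not either
-- because e is not a bridge. For the latter one needs that removing an edge never decreases the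
-- count of the union–find procedure `components`: the labelling built from a sublist of the edges
-- refines the one built from all of them, and every root of the coarser labelling is a root of the
-- finer one.
module Submission where

open import Defs
open import Data.Bool using (T; true; false; if_then_else_)
open import Data.Bool.ListAction using (or)
open import Data.Bool.Properties using (T?)
open import Data.Fin using (zero; suc)
open import Data.Integer using (ℤ; +_; _+_; _-_; _*_; _^_)
open import Data.Integer.Properties using (+-identityˡ; +-assoc; +-comm; +-commutativeSemigroup)
open import Algebra.Properties.CommutativeSemigroup +-commutativeSemigroup using (interchange)
open import Data.List using (List; []; _∷_; _++_; map; concat; concatMap; foldl; upTo; lookup; removeAt; updateAt)
open import Data.List.Properties using (map-∘; map-cong; map-++; length-map; concatMap-cong)
open import Data.List.Relation.Binary.Sublist.Propositional using (_⊆_; []; _∷_; _∷ʳ_; ⊆-refl)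
open import Data.List.Relation.Binary.Sublist.Propositional.Properties using (map⁺; filter⁺; length-mono-≤)
open import Data.Nat as ℕ using (ℕ; _≤_; _∸_; _⊓_; _⊔_; _≡ᵇ_)
open import Data.Nat.Properties
  using (≤-refl; ≤-trans; ≤-antisym; ≤-total; ≮⇒≥; ≡ᵇ⇒≡; ≡⇒≡ᵇ; m⊓n≤m⊔n; ⊓-sel; ⊔-sel;
         m≤n⇒m⊓n≡m; m≤n⇒m⊔n≡n; m≥n⇒m⊓n≡n; m≥n⇒m⊔n≡m)
open import Data.Product using (_×_; _,_; proj₁; proj₂)
open import Data.Sum using (_⊎_; inj₁; inj₂; [_,_]′)
open import Function using (_∘_)
open import Relation.Binary.PropositionalEquality
  using (_≡_; _≢_; refl; sym; trans; cong; cong₂; subst; module ≡-Reasoning)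
open import Relation.Nullary using (¬_; contradiction)

open ≡-Reasoning

-- `merge f (x , y)` is `relabel (f x ⊓ f y) (f x ⊔ f y) ∘ f` by definition.
relabel : ℕ → ℕ → ℕ → ℕ
relabel m M l = if l ≡ᵇ M then m else l

relabel-cases : ∀ m M l → (l ≡ M × relabel m M l ≡ m) ⊎ (l ≢ M × relabel m M l ≡ l)
relabel-cases m M l with l ≡ᵇ M in eq
... | true  = inj₁ (≡ᵇ⇒≡ l M (subst T (sym eq) _) , refl)
... | false = inj₂ ((λ l≡M → subst T eq (≡⇒≡ᵇ l M l≡M)) , refl)

relabel-≤ : ∀ {m M} l → m ≤ M → relabel m M l ≤ l
relabel-≤ {m} {M} l m≤M with relabel-cases m M l
... | inj₁ (refl , eq) = subst (_≤ l) (sym eq) m≤M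
... | inj₂ (_ , eq)    = subst (_≤ l) (sym eq) ≤-refl

relabel-onto : ∀ m M l → l ≡ m ⊎ l ≡ M → relabel m M l ≡ m
relabel-onto m M l l∈mM with relabel-cases m M l
... | inj₁ (_ , eq) = eq
... | inj₂ (l≢M , eq) = trans eq ([ (λ l≡m → l≡m) , (λ l≡M → contradiction l≡M l≢M) ]′ l∈mM)

relabel-endpoint : ∀ a b l → l ≡ a ⊎ l ≡ b → relabel (a ⊓ b) (a ⊔ b) l ≡ a ⊓ b
relabel-endpoint a b l l∈ab with ≤-total a b
... | inj₁ a≤b rewrite m≤n⇒m⊓n≡m a≤b | m≤n⇒m⊔n≡n a≤b = relabel-onto a b l l∈ab
... | inj₂ b≤a rewrite m≥n⇒m⊓n≡n b≤a | m≥n⇒m⊔n≡m b≤a = relabel-onto b a l ([ inj₂ , inj₁ ]′ l∈ab)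

relabel-fibre : ∀ m M l l′ → relabel m M l ≡ relabel m M l′ →
                l ≡ l′ ⊎ ((l ≡ m ⊎ l ≡ M) × (l′ ≡ m ⊎ l′ ≡ M))
relabel-fibre m M l l′ eq with relabel-cases m M l | relabel-cases m M l′
... | inj₁ (l≡M , _)  | inj₁ (l′≡M , _)  = inj₁ (trans l≡M (sym l′≡M))
... | inj₁ (l≡M , p)  | inj₂ (_ , p′)    = inj₂ (inj₂ l≡M , inj₁ (trans (sym p′) (trans (sym eq) p)))
... | inj₂ (_ , p)    | inj₁ (l′≡M , p′) = inj₂ (inj₁ (trans (sym p) (trans eq p′)) , inj₂ l′≡M)
... | inj₂ (_ , p)    | inj₂ (_ , p′)    = inj₁ (trans (sym p) (trans eq p′))

Idempotent : (ℕ → ℕ) → Set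
Idempotent f = ∀ i → f (f i) ≡ f i

Deflationary : (ℕ → ℕ) → Set
Deflationary f = ∀ i → f i ≤ i

Refines : (ℕ → ℕ) → (ℕ → ℕ) → Set
Refines f g = ∀ i j → f i ≡ f j → g i ≡ g j

refines-trans : ∀ {f g h} → Refines f g → Refines g h → Refines f h
refines-trans f⊑g g⊑h i j eq = g⊑h i j (f⊑g i j eq)

⊓⊔-endpoint : ∀ a b {k} → k ≡ a ⊓ b ⊎ k ≡ a ⊔ b → k ≡ a ⊎ k ≡ b
⊓⊔-endpoint a b (inj₁ k≡m) = [ (λ e → inj₁ (trans k≡m e)) , (λ e → inj₂ (trans k≡m e)) ]′ (⊓-sel a b)
⊓⊔-endpoint a b (inj₂ k≡M) = [ (λ e → inj₁ (trans k≡M e)) , (λ e → inj₂ (trans k≡M e)) ]′ (⊔-sel a b)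

merge-deflationary : ∀ {f} p → Deflationary f → Deflationary (merge f p)
merge-deflationary {f} (x , y) f≤ i = ≤-trans (relabel-≤ (f i) (m⊓n≤m⊔n (f x) (f y))) (f≤ i)

merge-idempotent : ∀ {f} p → Idempotent f → Idempotent (merge f p)
merge-idempotent {f} (x , y) idem i with relabel-cases m M (f i)
  where m = f x ⊓ f y ; M = f x ⊔ f y
... | inj₁ (_ , eq) = begin
  relabel m M (f (relabel m M (f i))) ≡⟨ cong (relabel m M ∘ f) eq ⟩
  relabel m M (f m)                   ≡⟨ cong (relabel m M) (f-fixes-label (⊓⊔-endpoint (f x) (f y) (inj₁ refl))) ⟩
  relabel m M m                       ≡⟨ relabel-onto m M m (inj₁ refl) ⟩
  m                                   ≡⟨ sym eq ⟩
  relabel m M (f i)                   ∎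
  where
  m = f x ⊓ f y ; M = f x ⊔ f y
  f-fixes-label : ∀ {l} → l ≡ f x ⊎ l ≡ f y → f l ≡ l
  f-fixes-label (inj₁ refl) = idem x
  f-fixes-label (inj₂ refl) = idem y
... | inj₂ (_ , eq) =
  trans (cong (relabel (f x ⊓ f y) (f x ⊔ f y) ∘ f) eq) (cong (relabel (f x ⊓ f y) (f x ⊔ f y)) (idem i))

refines-merge : ∀ f p → Refines f (merge f p)
refines-merge f (x , y) i j eq = cong (relabel (f x ⊓ f y) (f x ⊔ f y)) eq

merge-monotone : ∀ {f g} p → Refines f g → Refines (merge f p) (merge g p)
merge-monotone {f} {g} (x , y) f⊑g i j eq
  with relabel-fibre (f x ⊓ f y) (f x ⊔ f y) (f i) (f j) eq
... | inj₁ fi≡fj = cong (relabel (g x ⊓ g y) (g x ⊔ g y)) (f⊑g i j fi≡fj)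
... | inj₂ (i-merged , j-merged) = trans (to-min i-merged) (sym (to-min j-merged))
  where
  to-min : ∀ {k} → f k ≡ f x ⊓ f y ⊎ f k ≡ f x ⊔ f y → merge g (x , y) k ≡ g x ⊓ g y
  to-min {k} k-merged = relabel-endpoint (g x) (g y) (g k)
    ([ (λ e → inj₁ (f⊑g k x e)) , (λ e → inj₂ (f⊑g k y e)) ]′ (⊓⊔-endpoint (f x) (f y) k-merged))

foldl-merge-⊆ : ∀ {f g ps qs} → ps ⊆ qs → Refines f g → Refines (foldl merge f ps) (foldl merge g qs)
foldl-merge-⊆         []            f⊑g = f⊑g
foldl-merge-⊆ {g = g} (q ∷ʳ ps⊆qs)  f⊑g = foldl-merge-⊆ ps⊆qs (refines-trans f⊑g (refines-merge g q))
foldl-merge-⊆ {ps = p ∷ _} (refl ∷ ps⊆qs) f⊑g = foldl-merge-⊆ ps⊆qs (merge-monotone p f⊑g)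

foldl-merge-idempotent : ∀ {f} ps → Idempotent f → Idempotent (foldl merge f ps)
foldl-merge-idempotent []       idem = idem
foldl-merge-idempotent (p ∷ ps) idem = foldl-merge-idempotent ps (merge-idempotent p idem)

foldl-merge-deflationary : ∀ {f} ps → Deflationary f → Deflationary (foldl merge f ps)
foldl-merge-deflationary []       f≤ = f≤
foldl-merge-deflationary (p ∷ ps) f≤ = foldl-merge-deflationary ps (merge-deflationary p f≤)

labels-idempotent : ∀ ps → Idempotent (labels ps)
labels-idempotent ps = foldl-merge-idempotent ps (λ _ → refl)

labels-deflationary : ∀ ps → Deflationary (labels ps)
labels-deflationary ps = foldl-merge-deflationary ps (λ _ → ≤-refl)

labels-⊆ : ∀ {ps qs} → ps ⊆ qs → Refines (labels ps) (labels qs)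
labels-⊆ ps⊆qs = foldl-merge-⊆ ps⊆qs (λ _ _ eq → eq)

-- g (f i) ≡ g i ≡ i and g (f i) ≤ f i ≤ i squeeze f i onto i.
root-of-refinement : ∀ {f g} → Refines f g → Idempotent f → Deflationary f → Deflationary g →
                     ∀ i → g i ≡ i → f i ≡ i
root-of-refinement {f} {g} f⊑g idem f≤ g≤ i gi≡i =
  ≤-antisym (f≤ i) (subst (_≤ f i) (trans (f⊑g (f i) i (idem i)) gi≡i) (g≤ (f i)))

components-antitone : ∀ pts {ps qs} → ps ⊆ qs → components pts qs ≤ components pts ps
components-antitone pts {ps} {qs} ps⊆qs =
  length-mono-≤ (filter⁺ (T? ∘ isRoot qs) (T? ∘ isRoot ps) root-preserved (⊆-refl {x = pts}))
  where
  isRoot : List (ℕ × ℕ) → ℕ → _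
  isRoot rs i = labels rs i ≡ᵇ i
  root-preserved : ∀ {i j} → i ≡ j → T (isRoot qs i) → T (isRoot ps j)
  root-preserved {i} refl root =
    ≡⇒≡ᵇ (labels ps i) i
      (root-of-refinement (labels-⊆ ps⊆qs) (labels-idempotent ps) (labels-deflationary ps)
                          (labels-deflationary qs) i (≡ᵇ⇒≡ (labels qs i) i root))

removeAt-⊆ : ∀ {A : Set} (xs : List A) k → removeAt xs k ⊆ xs
removeAt-⊆ (x ∷ xs) zero    = x ∷ʳ ⊆-refl
removeAt-⊆ (x ∷ xs) (suc k) = refl ∷ removeAt-⊆ xs k

kC-removeAt : ∀ V (es : List (Edge V)) k → kC V es ≤ kC V (removeAt es k)
kC-removeAt V es k = components-antitone (vertexCodes V) (map⁺ _ (removeAt-⊆ es k))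

nonBridge⇒kC-removeAt : ∀ G e → ¬ IsBridge G e → kC (V G) (edges (G ─ e)) ≡ kC (V G) (edges G)
nonBridge⇒kC-removeAt G e notBridge = ≤-antisym (≮⇒≥ notBridge) (kC-removeAt (V G) (edges G) e)

deactivate : ∀ {V} → Edge V → Edge V
deactivate d = mkEdge (Edge.v₁ d) (Edge.s₁ d) (Edge.v₂ d) (Edge.s₂ d) false

module _ {V : ℕ} where

  -- The edge functions of Defs read only endpoints and slots, so their `g-blind` hypothesis is
  -- `λ _ → refl`. As `_++_` is not injective, the unchanged prefixes of `jacketEdges` and
  -- `bubbleFaceEdges` have to be written out below.
  map-deactivate : ∀ {B : Set} (g : Edge V → B) → (∀ d → g (deactivate d) ≡ g d) →
                   ∀ H → map g (map deactivate H) ≡ map g H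
  map-deactivate g g-blind H = trans (sym (map-∘ H)) (map-cong g-blind H)

  kC-deactivate : ∀ H → kC V (map deactivate H) ≡ kC V H
  kC-deactivate H = cong (components (vertexCodes V)) (map-deactivate _ (λ _ → refl) H)

  slotUsed-deactivate : ∀ H v a → slotUsed (map deactivate H) v a ≡ slotUsed H v a
  slotUsed-deactivate H v a = cong or (map-deactivate _ (λ _ → refl) H)

  jacketEdges-deactivate : ∀ H → jacketEdges V (map deactivate H) ≡ jacketEdges V H
  jacketEdges-deactivate H =
    cong (concatMap (λ v → map (λ a → jpt v a 1 , jpt v ((a ℕ.+ 1) ℕ.% 4) 0) (upTo 4)) (upTo V) ++_)
      (cong₂ _++_
        (cong concat (map-deactivate _ (λ _ → refl) H))
        (concatMap-cong (λ v → concatMap-cong (λ a →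
          cong (λ b → if b then [] else (jpt v a 0 , jpt v a 1) ∷ []) (slotUsed-deactivate H v a))
          (upTo 4)) (upTo V)))

  faces-deactivate : ∀ H → faces V (map deactivate H) ≡ faces V H
  faces-deactivate H = cong (components (jacketPoints V)) (jacketEdges-deactivate H)

  bubbleFaceEdges-deactivate : ∀ H → bubbleFaceEdges V (map deactivate H) ≡ bubbleFaceEdges V H
  bubbleFaceEdges-deactivate H =
    cong (concatMap (λ v → map (λ t → bpt v (proj₁ t) (proj₁ (proj₂ t)) (proj₂ (proj₂ t))
                                    , bpt v (proj₁ t) (proj₂ (proj₂ t)) (proj₁ (proj₂ t))) triples) (upTo V) ++_)
      (cong₂ _++_
        (cong concat (map-deactivate _ (λ _ → refl) H))
        (concatMap-cong (λ v → concatMap-cong (λ a →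
          cong (λ b → if b then [] else
                        map (λ p → bpt v (proj₁ p) a (proj₂ p) , bpt v (proj₁ p) a (fourth a (proj₁ p) (proj₂ p)))
                            (sidesOfSlot a))
               (slotUsed-deactivate H v a))
          (upTo 4)) (upTo V)))

  twiceGenusSum-deactivate : ∀ H → twiceGenusSum V (map deactivate H) ≡ twiceGenusSum V H
  twiceGenusSum-deactivate H =
    cong₂ _∸_
      (cong₂ ℕ._+_
        (cong (λ K → 2 ℕ.* components (upTo (V ℕ.* 4)) K) (cong concat (map-deactivate _ (λ _ → refl) H)))
        (cong (3 ℕ.*_) (length-map deactivate H)))
      (cong (λ K → 4 ℕ.* V ℕ.+ components (bubblePoints V) K) (bubbleFaceEdges-deactivate H))

  deactivate-updateAt : ∀ (es : List (Edge V)) i → map deactivate (updateAt es i deactivate) ≡ map deactivate es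
  deactivate-updateAt (d ∷ es) zero    = refl
  deactivate-updateAt (d ∷ es) (suc i) = cong (deactivate d ∷_) (deactivate-updateAt es i)

  kC-updateAt-deactivate : ∀ (es : List (Edge V)) i → kC V (updateAt es i deactivate) ≡ kC V es
  kC-updateAt-deactivate es i = begin
    kC V (updateAt es i deactivate)                  ≡⟨ kC-deactivate (updateAt es i deactivate) ⟨
    kC V (map deactivate (updateAt es i deactivate)) ≡⟨ cong (kC V) (deactivate-updateAt es i) ⟩
    kC V (map deactivate es)                         ≡⟨ kC-deactivate es ⟩
    kC V es                                          ∎

monomial : (x y z t : ℤ) (a b c d : ℕ) → ℤ
monomial x y z t a b c d = (x - + 1) ^ a * y ^ b * z ^ c * t ^ d

monomial-cong : ∀ x y z t {a a′ b b′ c c′ d d′} → a ≡ a′ → b ≡ b′ → c ≡ c′ → d ≡ d′ →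
                monomial x y z t a b c d ≡ monomial x y z t a′ b′ c′ d′
monomial-cong x y z t refl refl refl refl = refl

weight : (x y z t : ℤ) (V r : ℕ) → List (Edge V) → ℤ
weight x y z t V r H =
  monomial x y z t (r ∸ rk V H) (nul V H) ((kC V H ℕ.+ nul V H) ∸ faces V H) (twiceGenusSum V H)

weight-deactivate : ∀ x y z t V r H → weight x y z t V r (map deactivate H) ≡ weight x y z t V r H
weight-deactivate x y z t V r H =
  monomial-cong x y z t (cong (r ∸_) rk-eq) nul-eq
    (cong₂ _∸_ (cong₂ ℕ._+_ (kC-deactivate H) nul-eq) (faces-deactivate H)) (twiceGenusSum-deactivate H)
  where
  rk-eq : rk V (map deactivate H) ≡ rk V H
  rk-eq = cong (V ∸_) (kC-deactivate H)
  nul-eq : nul V (map deactivate H) ≡ nul V H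
  nul-eq = cong₂ _∸_ (length-map deactivate H) rk-eq

DeactivationInvariant : ∀ {V} → (List (Edge V) → ℤ) → Set
DeactivationInvariant {V} Ψ = ∀ H H′ → map deactivate H ≡ map deactivate H′ → Ψ H ≡ Ψ H′

weight-invariant : ∀ x y z t V r → DeactivationInvariant (weight x y z t V r)
weight-invariant x y z t V r H H′ eq =
  trans (sym (weight-deactivate x y z t V r H))
        (trans (cong (weight x y z t V r) eq) (weight-deactivate x y z t V r H′))

-- `TPoly G x y z t` is `subgraphSum (edges G) (weight x y z t (V G) (rk (V G) (edges G)))` by
-- definition, and `G ／ e` has edge list `updateAt (edges G) e deactivate`.
subgraphSum : ∀ {V} → List (Edge V) → (List (Edge V) → ℤ) → ℤ
subgraphSum es Ψ = sumℤ (map (λ m → Ψ (select es m)) (subgraphMasks (map Edge.active es)))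

sumℤ-++ : ∀ xs ys → sumℤ (xs ++ ys) ≡ sumℤ xs + sumℤ ys
sumℤ-++ []       ys = sym (+-identityˡ (sumℤ ys))
sumℤ-++ (x ∷ xs) ys = trans (cong (_+_ x) (sumℤ-++ xs ys)) (sym (+-assoc x (sumℤ xs) (sumℤ ys)))

module _ {V : ℕ} where

  subgraphSum-active : ∀ (d : Edge V) es Ψ → Edge.active d ≡ true →
    subgraphSum (d ∷ es) Ψ ≡ subgraphSum es (Ψ ∘ (d ∷_)) + subgraphSum es Ψ
  subgraphSum-active d@(mkEdge _ _ _ _ true) es Ψ refl = begin
    sumℤ (map f (map (true ∷_) S ++ map (false ∷_) S))
      ≡⟨ cong sumℤ (map-++ f (map (true ∷_) S) _) ⟩
    sumℤ (map f (map (true ∷_) S) ++ map f (map (false ∷_) S))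
      ≡⟨ sumℤ-++ (map f (map (true ∷_) S)) _ ⟩
    sumℤ (map f (map (true ∷_) S)) + sumℤ (map f (map (false ∷_) S))
      ≡⟨ cong₂ _+_ (cong sumℤ (sym (map-∘ S))) (cong sumℤ (sym (map-∘ S))) ⟩
    subgraphSum es (Ψ ∘ (d ∷_)) + subgraphSum es Ψ
      ∎
    where
    S = subgraphMasks (map Edge.active es)
    f = λ m → Ψ (select (d ∷ es) m)

  subgraphSum-passive : ∀ (d : Edge V) es Ψ → Edge.active d ≡ false →
    subgraphSum (d ∷ es) Ψ ≡ subgraphSum es (Ψ ∘ (d ∷_))
  subgraphSum-passive d@(mkEdge _ _ _ _ false) es Ψ refl =
    cong sumℤ (sym (map-∘ (subgraphMasks (map Edge.active es))))

  prefix-invariant : ∀ (d : Edge V) {Ψ : List (Edge V) → ℤ} →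
                     DeactivationInvariant Ψ → DeactivationInvariant (Ψ ∘ (d ∷_))
  prefix-invariant d inv H H′ eq = inv (d ∷ H) (d ∷ H′) (cong (deactivate d ∷_) eq)

  subgraphSum-deletion-contraction : ∀ (es : List (Edge V)) i Ψ →
    Edge.active (lookup es i) ≡ true → DeactivationInvariant Ψ →
    subgraphSum es Ψ ≡ subgraphSum (removeAt es i) Ψ + subgraphSum (updateAt es i deactivate) Ψ
  subgraphSum-deletion-contraction (d ∷ es) zero Ψ active inv = begin
    subgraphSum (d ∷ es) Ψ                               ≡⟨ subgraphSum-active d es Ψ active ⟩
    subgraphSum es (Ψ ∘ (d ∷_)) + subgraphSum es Ψ       ≡⟨ +-comm (subgraphSum es (Ψ ∘ (d ∷_))) _ ⟩
    subgraphSum es Ψ + subgraphSum es (Ψ ∘ (d ∷_))       ≡⟨ cong (_+_ (subgraphSum es Ψ)) contracted ⟩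
    subgraphSum es Ψ + subgraphSum (deactivate d ∷ es) Ψ ∎
    where
    contracted : subgraphSum es (Ψ ∘ (d ∷_)) ≡ subgraphSum (deactivate d ∷ es) Ψ
    contracted = trans
      (cong sumℤ (map-cong (λ m → inv (d ∷ select es m) (deactivate d ∷ select es m) refl)
                           (subgraphMasks (map Edge.active es))))
      (sym (subgraphSum-passive (deactivate d) es Ψ refl))
  subgraphSum-deletion-contraction (d@(mkEdge _ _ _ _ true) ∷ es) (suc i) Ψ active inv = begin
    subgraphSum (d ∷ es) Ψ
      ≡⟨ subgraphSum-active d es Ψ refl ⟩
    subgraphSum es (Ψ ∘ (d ∷_)) + subgraphSum es Ψ
      ≡⟨ cong₂ _+_ (subgraphSum-deletion-contraction es i (Ψ ∘ (d ∷_)) active (prefix-invariant d inv))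
                    (subgraphSum-deletion-contraction es i Ψ active inv) ⟩
    (Σ− (Ψ ∘ (d ∷_)) + Σ/ (Ψ ∘ (d ∷_))) + (Σ− Ψ + Σ/ Ψ)
      ≡⟨ interchange (Σ− (Ψ ∘ (d ∷_))) (Σ/ (Ψ ∘ (d ∷_))) (Σ− Ψ) (Σ/ Ψ) ⟩
    (Σ− (Ψ ∘ (d ∷_)) + Σ− Ψ) + (Σ/ (Ψ ∘ (d ∷_)) + Σ/ Ψ)
      ≡⟨ sym (cong₂ _+_ (subgraphSum-active d (removeAt es i) Ψ refl)
                        (subgraphSum-active d (updateAt es i deactivate) Ψ refl)) ⟩
    subgraphSum (d ∷ removeAt es i) Ψ + subgraphSum (d ∷ updateAt es i deactivate) Ψ ∎
    where
    Σ− Σ/ : (List (Edge V) → ℤ) → ℤ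
    Σ− = subgraphSum (removeAt es i)
    Σ/ = subgraphSum (updateAt es i deactivate)
  subgraphSum-deletion-contraction (d@(mkEdge _ _ _ _ false) ∷ es) (suc i) Ψ active inv = begin
    subgraphSum (d ∷ es) Ψ
      ≡⟨ subgraphSum-passive d es Ψ refl ⟩
    subgraphSum es (Ψ ∘ (d ∷_))
      ≡⟨ subgraphSum-deletion-contraction es i (Ψ ∘ (d ∷_)) active (prefix-invariant d inv) ⟩
    subgraphSum (removeAt es i) (Ψ ∘ (d ∷_)) + subgraphSum (updateAt es i deactivate) (Ψ ∘ (d ∷_))
      ≡⟨ sym (cong₂ _+_ (subgraphSum-passive d (removeAt es i) Ψ refl)
                        (subgraphSum-passive d (updateAt es i deactivate) Ψ refl)) ⟩
    subgraphSum (d ∷ removeAt es i) Ψ + subgraphSum (d ∷ updateAt es i deactivate) Ψ ∎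

theorem3 : (G : TensorGraph) → WellFormed G → Orientable G →
           (e : EdgeIx G) → IsActive G e → IsRegular G e →
           (x y z t : ℤ) →
           TPoly G x y z t ≡ TPoly (G ─ e) x y z t + TPoly (G ／ e) x y z t
theorem3 G@(mkTG V es) _ _ e active (notBridge , _) x y z t = begin
  subgraphSum es (weight x y z t V (rk V es))
    ≡⟨ subgraphSum-deletion-contraction es e (weight x y z t V (rk V es)) active
                                             (weight-invariant x y z t V (rk V es)) ⟩
  subgraphSum (removeAt es e) (weight x y z t V (rk V es))
    + subgraphSum (updateAt es e deactivate) (weight x y z t V (rk V es))
    ≡⟨ cong₂ _+_ (cong (λ r → subgraphSum (removeAt es e) (weight x y z t V r)) deletion-rank)
                  (cong (λ r → subgraphSum (updateAt es e deactivate) (weight x y z t V r)) contraction-rank) ⟩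
  subgraphSum (removeAt es e) (weight x y z t V (rk V (removeAt es e)))
    + subgraphSum (updateAt es e deactivate) (weight x y z t V (rk V (updateAt es e deactivate))) ∎
  where
  deletion-rank : rk V es ≡ rk V (removeAt es e)
  deletion-rank = cong (V ∸_) (sym (nonBridge⇒kC-removeAt G e notBridge))
  contraction-rank : rk V es ≡ rk V (updateAt es e deactivate)
  contraction-rank = cong (V ∸_) (sym (kC-updateAt-deactivate es e))
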